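{- Let $k\ge1$ be an integer and $\{U_n\}_{n\ge0}=\{U_n(k)\}$ defined by $U_0=0$, $U_1=1$, $U_{n+2}=(4k+2)U_{n+1}-U_n$. For a positive integer $m$ let $z(m)$ be the smallest $n\ge1$ with $m\mid U_n$. Let $p$ be an odd prime with $p\mid k+1$ and let $b\ge1$. Let $i,j\ge0$ be integers. If $i\equiv j\pmod 2$, then $U_i\equiv U_j\pmod{p^b}$ holds if and only if $i\equiv j\pmod{z(p^b)}$. If $i\not\equiv j\pmod 2$, then $U_i\equiv U_j\pmod{p^b}$ holds if and only if $i+j\equiv0\pmod{z(p^b)}$. -}

module Defs where

open import Data.Nat as ℕ using (ℕ; zero; suc; _≤_; _<_)
open import Data.Integer as ℤ using (ℤ; +_; _-_; _*_)
open import Data.Integer.Divisibility as ℤD using ()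
open import Relation.Nullary using (¬_)
open import Data.Product using (_×_)

U : ℕ → ℕ → ℤ
U k zero = + 0
U k (suc zero) = + 1
U k (suc (suc n)) = (+ (4 ℕ.* k ℕ.+ 2)) * U k (suc n) - U k n

infix 4 _≡_[mod_] _≡ₙ_[mod_]

_≡_[mod_] : ℤ → ℤ → ℤ → Set
a ≡ b [mod m ] = m ℤD.∣ (a - b)

_≡ₙ_[mod_] : ℕ → ℕ → ℕ → Set
a ≡ₙ b [mod m ] = (+ a) ≡ (+ b) [mod (+ m) ]

IsRank : ℕ → ℕ → ℕ → Set
IsRank k m z = (1 ≤ z) × ((+ m) ℤD.∣ U k z) × (∀ n → 1 ≤ n → n < z → ¬ ((+ m) ℤD.∣ U k n))

-- Let U be the Lucas sequence U₀ = 0, U₁ = 1, U_{n+2} = A U_{n+1} - U_n with A = 4k + 2, and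
-- let p be an odd prime with p ∣ k + 1, so that A ≡ -2 (mod p).  The proof rests on two
-- factorisations of gaps of U, valid for every k:
--   U_{j+2r}   - U_j = U_r · V_{j+r},           V_n = 2 U_{n+1} - A U_n,
--   U_{j+2r+1} - U_j = S_r · D_{j+r},           S_n = U_{n+1} + U_n,  D_n = U_{n+1} - U_n,
-- which follow from the addition formula and a subtraction formula (a consequence of Cassini).
-- Modulo p we have S_{n+1} ≡ -S_n and V_n ≡ 2 S_n, so S_n and V_n are never divisible by p; a
-- factor prime to p can be cancelled from a divisibility by p^b.  Hence, for M = p^b,
--   M ∣ U_{j+2r} - U_j   ⇔  M ∣ U_r       ⇔  M ∣ U_{2r}        (taking j = 0 in the same identity),
--   M ∣ U_{j+2r+1} - U_j ⇔  M ∣ D_{j+r}   ⇔  M ∣ U_{2j+2r+1}.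
-- Finally, for any modulus m with rank of apparition z, m ∣ U_n ⇔ z ∣ n (Cassini shows that
-- U_{z-1} is a unit modulo m, so m-divisibility of U_n is z-periodic).  The theorem follows by
-- writing i = j + d (after swapping i and j if necessary) and splitting on the parity of d.
module Submission where

open import Defs
import Data.Nat.Divisibility as ℕD
open ℕD using () renaming (_∣_ to _∣ₙ_)
open import Data.Nat as ℕ using (ℕ; zero; suc; _<_; _^_; s≤s; z≤n)
import Data.Nat.Properties as ℕP
import Data.Integer as ℤ
import Data.Integer.Properties as ℤP
import Data.Integer.Divisibility.Signed as Signed
open import Data.Nat.Primality using (Prime; euclidsLemma; prime⇒nonZero; ¬prime[0]; ¬prime[1])
open import Data.Product using (_×_; _,_; Σ-syntax)
open import Data.Sum using (_⊎_; inj₁; inj₂; [_,_]′)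
open import Relation.Nullary using (¬_; contradiction)
open import Relation.Binary.PropositionalEquality
  using (_≡_; refl; sym; trans; cong; cong₂; subst; module ≡-Reasoning)
open import Function.Bundles using (_⇔_; mk⇔; Equivalence)
open import Function.Properties.Equivalence using (⇔-setoid) renaming (trans to ⇔-trans; sym to ⇔-sym)
open import Level using (0ℓ)
import Relation.Binary.Reasoning.Setoid as SetoidReasoning
import Data.Integer.Tactic.RingSolver as ℤ-Ring
import Data.Nat.Tactic.RingSolver as ℕ-Ring

module ⇔-Reasoning = SetoidReasoning (⇔-setoid 0ℓ)

module Identities (k : ℕ) where
  open ℤ using (ℤ; +_; _+_; _-_; _*_)
  open ≡-Reasoning

  A : ℤ
  A = + (4 ℕ.* k ℕ.+ 2)

  -- The companion sequence V n = 2 U (n + 1) - A U n, which equals U (n + 1) - U (n - 1).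
  V : ℕ → ℤ
  V n = + 2 * U k (suc n) - A * U k n

  S D : ℕ → ℤ
  S n = U k (suc n) + U k n
  D n = U k (suc n) - U k n

  addition : ∀ m n → U k (suc (m ℕ.+ n)) ≡ U k (suc m) * U k (suc n) - U k m * U k n
  addition zero n = base₀ (U k (suc n)) (U k n)
    where
    base₀ : ∀ x y → x ≡ + 1 * x - + 0 * y
    base₀ = ℤ-Ring.solve-∀
  addition (suc zero) n = base₁ A (U k (suc n)) (U k n)
    where
    base₁ : ∀ a x y → a * x - y ≡ (a * + 1 - + 0) * x - + 1 * y
    base₁ = ℤ-Ring.solve-∀
  addition (suc (suc m)) n = begin
      A * U k (suc (suc m ℕ.+ n)) - U k (suc (m ℕ.+ n))
    ≡⟨ cong₂ (λ u v → A * u - v) (addition (suc m) n) (addition m n) ⟩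
      A * (U k (suc (suc m)) * x - U k (suc m) * y) - (U k (suc m) * x - U k m * y)
    ≡⟨ step A (U k (suc m)) (U k m) x y ⟩
      (A * U k (suc (suc m)) - U k (suc m)) * x - U k (suc (suc m)) * y
    ∎
    where
    x = U k (suc n)
    y = U k n
    step : ∀ a q r x y → a * ((a * q - r) * x - q * y) - (q * x - r * y)
                         ≡ (a * (a * q - r) - q) * x - (a * q - r) * y
    step = ℤ-Ring.solve-∀

  cassini : ∀ n → U k (suc n) * U k (suc n) - U k (suc (suc n)) * U k n ≡ + 1
  cassini zero = base A
    where
    base : ∀ a → + 1 * + 1 - (a * + 1 - + 0) * + 0 ≡ + 1
    base = ℤ-Ring.solve-∀
  cassini (suc n) = trans (step A (U k n) (U k (suc n))) (cassini n)
    where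
    step : ∀ a x y → (a * y - x) * (a * y - x) - (a * (a * y - x) - y) * y ≡ y * y - (a * y - x) * x
    step = ℤ-Ring.solve-∀

  subtraction : ∀ j r → U k (j ℕ.+ r) * U k (suc r) - U k (suc (j ℕ.+ r)) * U k r ≡ U k j
  subtraction zero r = base (U k r) (U k (suc r))
    where
    base : ∀ x y → x * y - y * x ≡ + 0
    base = ℤ-Ring.solve-∀
  subtraction (suc zero) r = cassini r
  subtraction (suc (suc j)) r =
    trans (step A (U k (j ℕ.+ r)) (U k (suc (j ℕ.+ r))) (U k (suc r)) (U k r))
          (cong₂ (λ u v → A * u - v) (subtraction (suc j) r) (subtraction j r))
    where
    step : ∀ a p q y x → (a * q - p) * y - (a * (a * q - p) - q) * x
                         ≡ a * (q * y - (a * q - p) * x) - (p * y - q * x)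
    step = ℤ-Ring.solve-∀

  even-gap : ∀ j r → U k (j ℕ.+ 2 ℕ.* r) - U k j ≡ U k r * V (j ℕ.+ r)
  even-gap j zero = begin
      U k (j ℕ.+ 0) - U k j  ≡⟨ cong (λ n → U k n - U k j) (ℕP.+-identityʳ j) ⟩
      U k j - U k j          ≡⟨ vanish (U k j) (V (j ℕ.+ 0)) ⟩
      + 0 * V (j ℕ.+ 0)      ∎
    where
    vanish : ∀ x y → x - x ≡ + 0 * y
    vanish = ℤ-Ring.solve-∀
  even-gap j (suc r) = begin
      U k (j ℕ.+ 2 ℕ.* suc r) - U k j
    ≡⟨ cong₂ _-_ (trans (cong (U k) (index j r)) (addition r c)) (sym (subtraction j (suc r))) ⟩
      (U k (suc r) * U k (suc c) - U k r * U k c) - (U k c * U k (suc (suc r)) - U k (suc c) * U k (suc r))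
    ≡⟨ step A (U k (suc r)) (U k r) (U k c) (U k (suc c)) ⟩
      U k (suc r) * V c
    ∎
    where
    c = j ℕ.+ suc r
    index : ∀ j r → j ℕ.+ 2 ℕ.* suc r ≡ suc (r ℕ.+ (j ℕ.+ suc r))
    index = ℕ-Ring.solve-∀
    step : ∀ a x y p q → (x * q - y * p) - (p * (a * x - y) - q * x) ≡ x * (+ 2 * q - a * p)
    step = ℤ-Ring.solve-∀

  odd-gap : ∀ j r → U k (j ℕ.+ suc (2 ℕ.* r)) - U k j ≡ S r * D (j ℕ.+ r)
  odd-gap j r = begin
      U k (j ℕ.+ suc (2 ℕ.* r)) - U k j
    ≡⟨ cong₂ _-_ (trans (cong (U k) (index j r)) (addition r c)) (sym (subtraction j r)) ⟩
      (U k (suc r) * U k (suc c) - U k r * U k c) - (U k c * U k (suc r) - U k (suc c) * U k r)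
    ≡⟨ step (U k (suc r)) (U k r) (U k c) (U k (suc c)) ⟩
      S r * D c
    ∎
    where
    c = j ℕ.+ r
    index : ∀ j r → j ℕ.+ suc (2 ℕ.* r) ≡ suc (r ℕ.+ (j ℕ.+ r))
    index = ℕ-Ring.solve-∀
    step : ∀ x y p q → (x * q - y * p) - (p * x - q * y) ≡ (x + y) * (q - p)
    step = ℤ-Ring.solve-∀

module PrimePowers where
  open import Data.Nat using (_*_)
  open import Data.Nat.Divisibility
  open ℤ using (+_)

  odd-prime∤2 : ∀ {p} → Prime p → ¬ 2 ∣ p → ¬ p ∣ 2
  odd-prime∤2 {0} p-prime = contradiction p-prime ¬prime[0]
  odd-prime∤2 {1} p-prime = contradiction p-prime ¬prime[1]
  odd-prime∤2 {2} _ 2∤p = contradiction ∣-refl 2∤p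
  odd-prime∤2 {suc (suc (suc _))} _ _ p∣2 with ∣⇒≤ p∣2
  ... | s≤s (s≤s ())

  prime-power-cancel : ∀ {p y} → Prime p → ¬ p ∣ y → ∀ b {x} → p ^ b ∣ x * y → p ^ b ∣ x
  prime-power-cancel _ _ zero {x} _ = 1∣ x
  prime-power-cancel {p} {y} p-prime p∤y (suc b) {x} pᵇ⁺¹∣xy
    with euclidsLemma x y p-prime (∣-trans (m∣m*n (p ^ b)) pᵇ⁺¹∣xy)
  ... | inj₂ p∣y = contradiction p∣y p∤y
  ... | inj₁ (divides q refl) = subst (p ^ suc b ∣_) (ℕP.*-comm p q) (*-monoʳ-∣ p pᵇ∣q)
    where
    instance _ = prime⇒nonZero p-prime
    regroup : q * p * y ≡ p * (q * y)
    regroup = trans (cong (_* y) (ℕP.*-comm q p)) (ℕP.*-assoc p q y)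
    pᵇ∣q : p ^ b ∣ q
    pᵇ∣q = prime-power-cancel p-prime p∤y b (*-cancelˡ-∣ p (subst (p ^ suc b ∣_) regroup pᵇ⁺¹∣xy))

  prime-power-cancelʳ : ∀ {p} → Prime p → ∀ b {x y} → ¬ (+ p Signed.∣ y)
                      → (+ (p ^ b) Signed.∣ x ℤ.* y) ⇔ (+ (p ^ b) Signed.∣ x)
  prime-power-cancelʳ p-prime b {x} {y} p∤y = mk⇔ cancel (Signed.∣m⇒∣m*n y)
    where
    cancel : + (_ ^ b) Signed.∣ x ℤ.* y → + (_ ^ b) Signed.∣ x
    cancel d = Signed.∣ᵤ⇒∣ (prime-power-cancel p-prime (λ p∣y → p∤y (Signed.∣ᵤ⇒∣ p∣y)) b
                             (subst (_ ∣_) (ℤP.abs-* x y) (Signed.∣⇒∣ᵤ d)))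

  prime-power-cancelˡ : ∀ {p} → Prime p → ∀ b {x y} → ¬ (+ p Signed.∣ y)
                      → (+ (p ^ b) Signed.∣ y ℤ.* x) ⇔ (+ (p ^ b) Signed.∣ x)
  prime-power-cancelˡ p-prime b {x} {y} p∤y =
    subst (λ t → (+ (_ ^ b) Signed.∣ t) ⇔ _) (ℤP.*-comm x y) (prime-power-cancelʳ p-prime b p∤y)

-- Modulo an odd prime p dividing k + 1 we have A ≡ -2, which makes S and V units modulo p.
module OddPrimeDivisor (k p : ℕ) (p-prime : Prime p) (2∤p : ¬ 2 ∣ₙ p) (p∣k+1 : p ∣ₙ k ℕ.+ 1) where
  open ℤ using (ℤ; +_; _+_; _-_; _*_)
  open Signed
  open Identities k
  open PrimePowers using (odd-prime∤2)

  p∣A+2 : + p ∣ A + + 2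
  p∣A+2 = ∣ᵤ⇒∣ (subst (p ∣ₙ_) (four-times k) (ℕD.∣n⇒∣m*n 4 p∣k+1))
    where
    four-times : ∀ k → 4 ℕ.* (k ℕ.+ 1) ≡ 4 ℕ.* k ℕ.+ 2 ℕ.+ 2
    four-times = ℕ-Ring.solve-∀

  -- S₀ = 1 and S_{n+1} + S_n = (A + 2) U_{n+1} ≡ 0 (mod p), so S_n ≡ ±1 (mod p).
  p∤S : ∀ n → ¬ (+ p ∣ S n)
  p∤S zero p∣1 = ¬prime[1] (subst Prime (ℕD.∣1⇒≡1 (∣⇒∣ᵤ p∣1)) p-prime)
  p∤S (suc n) p∣Sₙ₊₁ = p∤S n (∣m+n∣m⇒∣n p∣sum p∣Sₙ₊₁)
    where
    consecutive : ∀ a x y → (a * y - x + y) + (y + x) ≡ (a + + 2) * y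
    consecutive = ℤ-Ring.solve-∀
    p∣sum : + p ∣ S (suc n) + S n
    p∣sum = subst (+ p ∣_) (sym (consecutive A (U k n) (U k (suc n)))) (∣m⇒∣m*n (U k (suc n)) p∣A+2)

  -- V_n = 2 S_n - (A + 2) U_n ≡ 2 S_n (mod p), and p divides neither 2 nor S_n.
  p∤V : ∀ n → ¬ (+ p ∣ V n)
  p∤V n p∣Vₙ = [ odd-prime∤2 p-prime 2∤p , (λ p∣Sₙ → p∤S n (∣ᵤ⇒∣ p∣Sₙ)) ]′
                  (euclidsLemma 2 _ p-prime (subst (p ∣ₙ_) (ℤP.abs-* (+ 2) (S n)) (∣⇒∣ᵤ p∣2Sₙ)))
    where
    companion : ∀ a x y → + 2 * (y + x) ≡ (+ 2 * y - a * x) + (a + + 2) * x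
    companion = ℤ-Ring.solve-∀
    p∣2Sₙ : + p ∣ + 2 * S n
    p∣2Sₙ = subst (+ p ∣_) (sym (companion A (U k n) (U k (suc n))))
                   (∣m∣n⇒∣m+n p∣Vₙ (∣m⇒∣m*n (U k n) p∣A+2))

module Rank (k m : ℕ) where
  open ℤ using (ℤ; +_; _-_; _*_)
  open Signed
  open import Data.Nat.DivMod using (_%_; _/_; m≡m%n+[m/n]*n; m%n<n)
  open Identities k

  -- If m ∣ U_{n+1} then U_n is a unit modulo m: by Cassini, U_{n+1}² - U_{n+2} U_n = 1.
  unit-before-zero : ∀ n {x} → + m ∣ U k (suc n) → + m ∣ x * U k n → + m ∣ x
  unit-before-zero n {x} m∣Uₙ₊₁ m∣xUₙ =
    subst (+ m ∣_) inverse (∣m∣n⇒∣m-n (∣m⇒∣m*n _ m∣Uₙ₊₁) (∣n⇒∣m*n (U k (suc (suc n))) m∣xUₙ))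
    where
    regroup : ∀ a b c x → a * (a * x) - b * (x * c) ≡ (a * a - b * c) * x
    regroup = ℤ-Ring.solve-∀
    inverse : U k (suc n) * (U k (suc n) * x) - U k (suc (suc n)) * (x * U k n) ≡ x
    inverse = trans (regroup (U k (suc n)) (U k (suc (suc n))) (U k n) x)
                    (trans (cong (_* x) (cassini n)) (ℤP.*-identityˡ x))

  -- If m ∣ U_z with z = z' + 1 then m ∣ U_{n+z} ⇔ m ∣ U_n, since U_{n+z} = U_{n+1} U_z - U_n U_{z'}.
  shift : ∀ z' → + m ∣ U k (suc z') → ∀ n → (+ m ∣ U k (n ℕ.+ suc z')) ⇔ (+ m ∣ U k n)
  shift z' m∣Uz n = mk⇔ backward forward
    where
    expand : U k (n ℕ.+ suc z') ≡ U k (suc n) * U k (suc z') - U k n * U k z'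
    expand = trans (cong (U k) (ℕP.+-suc n z')) (addition n z')
    m∣first : + m ∣ U k (suc n) * U k (suc z')
    m∣first = ∣n⇒∣m*n (U k (suc n)) m∣Uz
    backward : + m ∣ U k (n ℕ.+ suc z') → + m ∣ U k n
    -- from m ∣ U_{n+1} U_z - U_n U_{z'} and m ∣ U_z we get m ∣ U_n U_{z'}
    backward d = unit-before-zero z' m∣Uz
      (subst (+ m ∣_) (ℤP.neg-involutive _) (∣m⇒∣-m (∣m+n∣m⇒∣n (subst (+ m ∣_) expand d) m∣first)))
    forward : + m ∣ U k n → + m ∣ U k (n ℕ.+ suc z')
    forward d = subst (+ m ∣_) (sym expand) (∣m∣n⇒∣m-n m∣first (∣m⇒∣m*n (U k z') d))

  periodic : ∀ z' → + m ∣ U k (suc z') → ∀ q r → (+ m ∣ U k (r ℕ.+ q ℕ.* suc z')) ⇔ (+ m ∣ U k r)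
  periodic z' m∣Uz zero r = begin
      + m ∣ U k (r ℕ.+ 0)  ≡⟨ cong (λ t → + m ∣ U k t) (ℕP.+-identityʳ r) ⟩
      + m ∣ U k r          ∎
    where open ⇔-Reasoning
  periodic z' m∣Uz (suc q) r = begin
      + m ∣ U k (r ℕ.+ suc q ℕ.* z)           ≡⟨ cong (λ t → + m ∣ U k t) (regroup r q z) ⟩
      + m ∣ U k ((r ℕ.+ q ℕ.* z) ℕ.+ z)      ≈⟨ shift z' m∣Uz (r ℕ.+ q ℕ.* z) ⟩
      + m ∣ U k (r ℕ.+ q ℕ.* z)              ≈⟨ periodic z' m∣Uz q r ⟩
      + m ∣ U k r                            ∎
    where
    open ⇔-Reasoning
    z = suc z'
    regroup : ∀ r q z → r ℕ.+ (z ℕ.+ q ℕ.* z) ≡ r ℕ.+ q ℕ.* z ℕ.+ z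
    regroup = ℕ-Ring.solve-∀

  rank-divides : ∀ {z} → IsRank k m z → ∀ n → (+ m ∣ U k n) ⇔ (z ∣ₙ n)
  rank-divides {suc z'} (s≤s z≤n , m∣ᵤUz , minimal) n = mk⇔ to from
    where
    z = suc z'
    m∣Uz : + m ∣ U k z
    m∣Uz = ∣ᵤ⇒∣ m∣ᵤUz
    from : z ∣ₙ n → + m ∣ U k n
    from (ℕD.divides q refl) = Equivalence.from (periodic z' m∣Uz q 0) (∣ᵤ⇒∣ (ℕD._∣0 m))
    remainder-vanishes : ∀ r → r ≡ n % z → r < z → + m ∣ U k r → z ∣ₙ n
    remainder-vanishes zero r≡n%z _ _ = ℕD.m%n≡0⇒n∣m n z (sym r≡n%z)
    remainder-vanishes (suc r) _ r<z m∣Uᵣ = contradiction (∣⇒∣ᵤ m∣Uᵣ) (minimal (suc r) (s≤s z≤n) r<z)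
    to : + m ∣ U k n → z ∣ₙ n
    to m∣Uₙ = remainder-vanishes (n % z) refl (m%n<n n z)
      (Equivalence.to (periodic z' m∣Uz (n / z) (n % z)) (subst (λ t → + m ∣ U k t) (m≡m%n+[m/n]*n n z) m∣Uₙ))

unsigned⇔signed : ∀ a b m → (a ≡ b [mod m ]) ⇔ (m Signed.∣ a ℤ.- b)
unsigned⇔signed _ _ _ = mk⇔ Signed.∣ᵤ⇒∣ Signed.∣⇒∣ᵤ

module PrimePowerGaps (k p : ℕ) (p-prime : Prime p) (2∤p : ¬ 2 ∣ₙ p) (p∣k+1 : p ∣ₙ k ℕ.+ 1)
                      (b z : ℕ) (rank : IsRank k (p ^ b) z) where
  open ℤ using (ℤ; +_; _-_; _*_)
  open Signed using (_∣_)
  open Identities k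
  open OddPrimeDivisor k p p-prime 2∤p p∣k+1
  open PrimePowers using (prime-power-cancelʳ; prime-power-cancelˡ)
  open Rank k (p ^ b) using (rank-divides)
  open ⇔-Reasoning

  M : ℤ
  M = + (p ^ b)

  even-gap-congruence : ∀ j r → (U k (j ℕ.+ 2 ℕ.* r) ≡ U k j [mod M ]) ⇔ (z ∣ₙ 2 ℕ.* r)
  even-gap-congruence j r = begin
    U k (j ℕ.+ 2 ℕ.* r) ≡ U k j [mod M ]  ≈⟨ unsigned⇔signed (U k (j ℕ.+ 2 ℕ.* r)) (U k j) M ⟩
    M ∣ U k (j ℕ.+ 2 ℕ.* r) - U k j      ≡⟨ cong (M ∣_) (even-gap j r) ⟩
    M ∣ U k r * V (j ℕ.+ r)              ≈⟨ prime-power-cancelʳ p-prime b (p∤V (j ℕ.+ r)) ⟩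
    M ∣ U k r                            ≈⟨ prime-power-cancelʳ p-prime b (p∤V r) ⟨
    M ∣ U k r * V r                      ≡⟨ cong (M ∣_) (sym (even-gap 0 r)) ⟩
    M ∣ U k (2 ℕ.* r) - + 0              ≡⟨ cong (M ∣_) (ℤP.+-identityʳ _) ⟩
    M ∣ U k (2 ℕ.* r)                    ≈⟨ rank-divides rank (2 ℕ.* r) ⟩
    z ∣ₙ 2 ℕ.* r                         ∎

  odd-gap-congruence : ∀ j r → (U k (j ℕ.+ suc (2 ℕ.* r)) ≡ U k j [mod M ])
                              ⇔ (z ∣ₙ j ℕ.+ suc (2 ℕ.* r) ℕ.+ j)
  odd-gap-congruence j r = begin
    U k (j ℕ.+ suc (2 ℕ.* r)) ≡ U k j [mod M ]  ≈⟨ unsigned⇔signed (U k (j ℕ.+ suc (2 ℕ.* r))) (U k j) M ⟩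
    M ∣ U k (j ℕ.+ suc (2 ℕ.* r)) - U k j      ≡⟨ cong (M ∣_) (odd-gap j r) ⟩
    M ∣ S r * D c                              ≈⟨ prime-power-cancelˡ p-prime b (p∤S r) ⟩
    M ∣ D c                                    ≈⟨ prime-power-cancelˡ p-prime b (p∤S c) ⟨
    M ∣ S c * D c                              ≡⟨ cong (M ∣_) (sym (odd-gap 0 c)) ⟩
    M ∣ U k (suc (2 ℕ.* c)) - + 0              ≡⟨ cong (M ∣_) (ℤP.+-identityʳ _) ⟩
    M ∣ U k (suc (2 ℕ.* c))                    ≈⟨ rank-divides rank (suc (2 ℕ.* c)) ⟩
    z ∣ₙ suc (2 ℕ.* c)                         ≡⟨ cong (z ∣ₙ_) (index j r) ⟩
    z ∣ₙ j ℕ.+ suc (2 ℕ.* r) ℕ.+ j             ∎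
    where
    c = j ℕ.+ r
    index : ∀ j r → suc (2 ℕ.* (j ℕ.+ r)) ≡ j ℕ.+ suc (2 ℕ.* r) ℕ.+ j
    index = ℕ-Ring.solve-∀

open import Data.Nat using (ℕ; _≤_; _+_; _^_)
open import Data.Nat.Divisibility using (_∣_)
open import Data.Integer using (+_)
open import Function.Bundles using (_⇔_)

parity : ∀ d → Σ[ r ∈ ℕ ] (d ≡ 2 ℕ.* r ⊎ d ≡ suc (2 ℕ.* r))
parity zero = 0 , inj₁ refl
parity (suc d) with parity d
... | r , inj₁ refl = r , inj₂ refl
... | r , inj₂ refl = suc r , inj₁ (cong suc (sym (ℕP.+-suc r (r + 0))))

odd-not-even : ∀ r → ¬ 2 ∣ suc (2 ℕ.* r)
odd-not-even r (ℕD.divides q odd≡q*2) = ℕP.even≢odd q r (trans (ℕP.*-comm 2 q) (sym odd≡q*2))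

mod-sym : ∀ a b m → (a ≡ b [mod m ]) ⇔ (b ≡ a [mod m ])
mod-sym a b m = mk⇔ (swap a b) (swap b a)
  where
  swap : ∀ x y → (x ≡ y [mod m ]) → (y ≡ x [mod m ])
  swap x y = subst ((ℤ.∣ m ∣) ∣_) (ℤP.∣i-j∣≡∣j-i∣ x y)

gap-mod : ∀ m j d → (j + d ≡ₙ j [mod m ]) ⇔ (m ∣ d)
gap-mod m j d = mk⇔ (subst (m ∣_) distance) (subst (m ∣_) (sym distance))
  where
  cancel : ∀ x y → (x ℤ.+ y) ℤ.- x ≡ y
  cancel = ℤ-Ring.solve-∀
  distance : ℤ.∣ + (j + d) ℤ.- + j ∣ ≡ d
  distance = cong ℤ.∣_∣ (cancel (+ j) (+ d))

zero-mod : ∀ m n → (n ≡ₙ 0 [mod m ]) ⇔ (m ∣ n)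
zero-mod m n = mk⇔ (subst (m ∣_) (ℕP.+-identityʳ n)) (subst (m ∣_) (sym (ℕP.+-identityʳ n)))

module Theorem (k p : ℕ) (p-prime : Prime p) (2∤p : ¬ 2 ∣ p) (p∣k+1 : p ∣ k + 1)
               (b z : ℕ) (rank : IsRank k (p ^ b) z) where
  open PrimePowerGaps k p p-prime 2∤p p∣k+1 b z rank using (M; even-gap-congruence; odd-gap-congruence)
  open ⇔-Reasoning

  Conclusion : ℕ → ℕ → Set
  Conclusion i j = ((i ≡ₙ j [mod 2 ]) → ((U k i ≡ U k j [mod M ]) ⇔ (i ≡ₙ j [mod z ])))
                 × (¬ (i ≡ₙ j [mod 2 ]) → ((U k i ≡ U k j [mod M ]) ⇔ (i + j ≡ₙ 0 [mod z ])))

  conclusion-sym : ∀ i j → Conclusion j i → Conclusion i j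
  conclusion-sym i j (same-parity , other-parity) =
    (λ i≡j → begin
      U k i ≡ U k j [mod M ]  ≈⟨ mod-sym (U k i) (U k j) M ⟩
      U k j ≡ U k i [mod M ]  ≈⟨ same-parity (Equivalence.to (mod-sym (+ i) (+ j) (+ 2)) i≡j) ⟩
      j ≡ₙ i [mod z ]         ≈⟨ mod-sym (+ j) (+ i) (+ z) ⟩
      i ≡ₙ j [mod z ]         ∎) ,
    (λ i≢j → begin
      U k i ≡ U k j [mod M ]  ≈⟨ mod-sym (U k i) (U k j) M ⟩
      U k j ≡ U k i [mod M ]  ≈⟨ other-parity (λ j≡i → i≢j (Equivalence.to (mod-sym (+ j) (+ i) (+ 2)) j≡i)) ⟩
      j + i ≡ₙ 0 [mod z ]     ≡⟨ cong (λ n → n ≡ₙ 0 [mod z ]) (ℕP.+-comm j i) ⟩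
      i + j ≡ₙ 0 [mod z ]     ∎)

  conclusion-gap : ∀ j d → Conclusion (j + d) j
  conclusion-gap j d with parity d
  ... | r , inj₁ refl =
    (λ _ → ⇔-trans (even-gap-congruence j r) (⇔-sym (gap-mod z j (2 ℕ.* r)))) ,
    (λ odd → contradiction (Equivalence.from (gap-mod 2 j (2 ℕ.* r)) (ℕD.m∣m*n r)) odd)
  ... | r , inj₂ refl =
    (λ even → contradiction (Equivalence.to (gap-mod 2 j (suc (2 ℕ.* r))) even) (odd-not-even r)) ,
    (λ _ → ⇔-trans (odd-gap-congruence j r) (⇔-sym (zero-mod z (j + suc (2 ℕ.* r) + j))))

  conclusion-ordered : ∀ {i j} → j ≤ i → Conclusion i j
  conclusion-ordered {j = j} j≤i with ℕP.m≤n⇒∃[o]m+o≡n j≤i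
  ... | d , refl = conclusion-gap j d

-- By symmetry of the conclusion we may assume j ≤ i.
lemma16 : (k : ℕ) → 1 ≤ k → (p : ℕ) → Prime p → ¬ (2 ∣ p) → p ∣ k + 1 → (b : ℕ) → 1 ≤ b → (z : ℕ) → IsRank k (p ^ b) z → (i j : ℕ)
    → ((i ≡ₙ j [mod 2 ]) → ((U k i ≡ U k j [mod (+ (p ^ b)) ]) ⇔ (i ≡ₙ j [mod z ])))
      × (¬ (i ≡ₙ j [mod 2 ]) → ((U k i ≡ U k j [mod (+ (p ^ b)) ]) ⇔ (i + j ≡ₙ 0 [mod z ])))
lemma16 k _ p p-prime 2∤p p∣k+1 b _ z rank i j =
  [ conclusion-ordered , (λ i≤j → conclusion-sym i j (conclusion-ordered i≤j)) ]′ (ℕP.≤-total j i)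
  where open Theorem k p p-prime 2∤p p∣k+1 b z rank
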